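{- Let $n\ge 2$ and $0\le k\le n-2$, and let $K_n$ be the complete graph on vertex set $[n]$. For $1\le j\le n-k-1$, let $\mathcal{T}^j_{n-k}$ be the set of uprooted spanning trees of $K_n$ with root $n-k$ such that the highest child of the root equals $n-k-j$. Then \[|\mathcal{T}^j_{n-k}| = n^{n-k-j-2}\,(n-1)^{k+j-2}\,(2n-k-j-1).\]
   Context: A spanning tree with a distinguished root $r$ is oriented away from $r$; the children of $r$ are its neighbours in the tree, and the highest child is the largest of them. An uprooted spanning tree with root $r$ is a spanning tree rooted at $r$ in which $r$ is greater than all of its children. -}

module Defs where

open import Data.Nat using (ℕ; zero; suc; _<_; _≤_)
open import Data.Fin using (Fin; toℕ; inject₁; fromℕ)
open import Data.Bool using (Bool; T)
open import Data.Vec using (Vec; lookup)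
open import Data.Product using (Σ; _×_; ∃)
open import Relation.Nullary using (¬_)
open import Relation.Binary.PropositionalEquality using (_≡_)
open import Function.Definitions using (Injective)

-- Vertex set [n] is represented by Fin n; vertex v has label ⟦ v ⟧ = toℕ v + 1,
-- so labels range over 1..n and the order on vertices is the order of labels.
⟦_⟧ : ∀ {n} → Fin n → ℕ
⟦ v ⟧ = suc (toℕ v)

EdgeSet : ℕ → Set
EdgeSet n = Vec (Vec Bool n) n

Adj : ∀ {n} → EdgeSet n → Fin n → Fin n → Set
Adj A u v = T (lookup (lookup A u) v)

IsSimple : ∀ {n} → EdgeSet n → Set
IsSimple {n} A = (∀ (u v : Fin n) → Adj A u v → Adj A v u) × (∀ (u : Fin n) → ¬ Adj A u u)

data Walk {n} (A : EdgeSet n) : Fin n → Fin n → Set where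
  here : ∀ {u} → Walk A u u
  step : ∀ {u w v} → Adj A u w → Walk A w v → Walk A u v

Connected : ∀ {n} → EdgeSet n → Set
Connected {n} A = ∀ (u v : Fin n) → Walk A u v

-- A cycle of length m+3: an injective cyclic sequence of vertices with
-- consecutive vertices adjacent.
IsCycle : ∀ {n} (A : EdgeSet n) (m : ℕ) → (Fin (suc (suc (suc m))) → Fin n) → Set
IsCycle A m c =
  Injective _≡_ _≡_ c ×
  (∀ (i : Fin (suc (suc m))) → Adj A (c (inject₁ i)) (c (Fin.suc i))) ×
  Adj A (c (fromℕ (suc (suc m)))) (c Fin.zero)

Acyclic : ∀ {n} → EdgeSet n → Set
Acyclic {n} A = ∀ (m : ℕ) (c : Fin (suc (suc (suc m))) → Fin n) → ¬ IsCycle A m c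

IsSpanningTree : ∀ {n} → EdgeSet n → Set
IsSpanningTree A = IsSimple A × Connected A × Acyclic A

-- With root r (a vertex), the children of r are its neighbours in the tree.
-- Uprooted with root r: r is greater than all of its children.
Uprooted : ∀ {n} → EdgeSet n → Fin n → Set
Uprooted {n} A r = ∀ (c : Fin n) → Adj A r c → ⟦ c ⟧ < ⟦ r ⟧

HighestChild : ∀ {n} → EdgeSet n → Fin n → Fin n → Set
HighestChild {n} A r h = Adj A r h × (∀ (c : Fin n) → Adj A r c → ⟦ c ⟧ ≤ ⟦ h ⟧)

InT : ∀ {n} (root hc : ℕ) → EdgeSet n → Set
InT {n} root hc A =
  IsSpanningTree A ×
  Σ (Fin n) (λ r → ⟦ r ⟧ ≡ root × Uprooted A r ×
    Σ (Fin n) (λ h → ⟦ h ⟧ ≡ hc × HighestChild A r h))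

-- A spanning tree of K_n rooted at r is the same as a parent function p with p r = r along
-- which every vertex reaches r; breadth-first distances to r recover p from the tree, and
-- acyclicity forces every tree edge to join a vertex to its parent.  With h = n-k-j, the
-- tree lies in 𝒯^j_{n-k} iff h is a child of r = n-k and no vertex above h other than r is.
-- Deciding the u = n-k-j-1 vertices below h one at a time (child of r or not) gives the
-- recursion C(u+1,t,a) = C(u,t+1,a) + C(u,t,a+1) for the number C = constrainedForests of
-- such parent functions, where t counts the vertices that must not be children of r and a
-- the roots left once r is deleted.  When nothing is undecided, deleting r turns its
-- children into roots, leaving a forest on t + a vertices with a prescribed set of a roots;
-- there are a(t+a)^(t-1) of these, which the same recursion started at one of the roots
-- proves by induction.  With M = u + t + a the recursion solves to
-- M(M+1) C(u,t,a) = M^t (M+1)^u (a(M+1) + u), and t = k+j-1, a = 1 give the theorem.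

module Submission where

open import Defs
open import Data.Bool using (Bool; true; false; T; not; _∧_; _∨_)
open import Data.Bool.Properties using (T-∧; T-∨)
open import Data.Empty using (⊥; ⊥-elim)
open import Data.Fin using (Fin; toℕ; fromℕ; fromℕ<; inject₁; splitAt; join) renaming (zero to fzero; suc to fsuc)
open import Data.Fin.Properties
  using (_≟_; any?; toℕ-injective; toℕ-inject₁; toℕ-fromℕ; toℕ-fromℕ<; toℕ<n; splitAt-join; join-splitAt)
  renaming (suc-injective to fsuc-injective)
open import Data.Fin.Relation.Unary.Top using (view; ‵fromℕ; ‵inj₁)
open import Data.List using (List; length)
import Data.List as List
open import Data.List.Membership.Propositional using (_∈_)
open import Data.List.Membership.Propositional.Properties using (∈-tabulate⁺; ∈-tabulate⁻)
open import Data.List.Properties using (length-tabulate)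
open import Data.List.Relation.Unary.Unique.Propositional using (Unique)
open import Data.List.Relation.Unary.Unique.Propositional.Properties using (tabulate⁺)
open import Data.Nat using (ℕ; zero; suc; _+_; _*_; _∸_; _^_; _≤_; _<_; z≤n; s≤s; s≤s⁻¹; s<s; s<s⁻¹; _≤?_; _<?_)
open import Data.Nat.GeneralisedArithmetic using (fold; fold-+)
open import Data.Nat.Induction using (<-wellFounded)
open import Data.Nat.Properties
  using (≤-refl; ≤-trans; ≤-total; ≤-antisym; <-irrefl; <-asym; <-trans; <-≤-trans; ≤-<-trans; <-cmp;
         <⇒≤; <⇒≢; <⇒≱; ≰⇒>; ≮⇒≥; n≤1+n; n<1+n; m≤m+n; m<m+n; m≤n⇒m<n∨m≡n; +-monoʳ-≤; suc-injective;
         +-suc; +-comm; +-identityʳ; *-distribˡ-+; *-cancelˡ-≡;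
         m+n∸m≡n; m+n∸n≡m; m∸n+n≡m; n∸n≡0; ∸-+-assoc; ∸-monoʳ-<; ∸-cancelˡ-≡; m≤o∸n⇒m+n≤o)
open import Data.Nat.Tactic.RingSolver using (solve-∀)
open import Data.Product using (Σ; ∃; ∃₂; _×_; _,_; proj₁; proj₂)
open import Data.Sum using (_⊎_; inj₁; inj₂; [_,_]; swap) renaming (map to map-⊎)
open import Data.Unit using (tt)
open import Data.Vec using (lookup; tabulate)
open import Data.Vec.Functional using (updateAt)
open import Data.Vec.Functional.Properties using (updateAt-updates; updateAt-minimal)
open import Data.Vec.Properties using (lookup∘tabulate; tabulate∘lookup; tabulate-cong)
open import Function.Base using (_∘_; case_of_)
open import Function.Bundles using (_⇔_; mk⇔; Equivalence)
open import Induction.WellFounded using (Acc; acc)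
open import Level using (0ℓ)
open import Relation.Binary using (Rel; Symmetric; Transitive)
open import Relation.Binary.Definitions using (DecidableEquality; tri<; tri≈; tri>)
open import Relation.Binary.PropositionalEquality
  using (_≡_; _≢_; refl; sym; trans; cong; cong₂; subst; subst₂; _≗_; module ≡-Reasoning)
open import Relation.Nullary using (¬_; Dec; yes; no; contradiction; ¬?; _⊎-dec_; _×-dec_)
open import Relation.Nullary.Decidable
  using (T?; map′; ⌊_⌋; toWitness; fromWitness; toWitnessFalse; fromWitnessFalse)
open import Relation.Unary using (Pred; Decidable; Empty; _≐_; _∪_)

private
  variable
    n : ℕ

record Enumeration {X : Set} (_≈_ : Rel X 0ℓ) (P : Pred X 0ℓ) (N : ℕ) : Set where
  field
    enum      : Fin N → X
    injective : ∀ {i j} → enum i ≈ enum j → i ≡ j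
    sound     : ∀ i → P (enum i)
    complete  : ∀ {x} → P x → ∃ λ i → enum i ≈ x

open Enumeration

module _ {X : Set} {_≈_ : Rel X 0ℓ} where

  Enumeration-≐ : ∀ {P Q N} → P ≐ Q → Enumeration _≈_ P N → Enumeration _≈_ Q N
  Enumeration-≐ (P⊆Q , Q⊆P) E = record
    { enum = enum E ; injective = injective E
    ; sound = λ i → P⊆Q (sound E i) ; complete = λ q → complete E (Q⊆P q) }

  Enumeration-empty : ∀ {P} → Empty P → Enumeration _≈_ P 0
  Enumeration-empty ∄P = record
    { enum = λ () ; injective = λ { {()} } ; sound = λ () ; complete = λ {x} p → ⊥-elim (∄P x p) }

  Enumeration-singleton : ∀ {P x} → P x → (∀ {y} → P y → x ≈ y) → Enumeration _≈_ P 1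
  Enumeration-singleton {x = x} px unique = record
    { enum = λ _ → x ; injective = λ { {fzero} {fzero} _ → refl }
    ; sound = λ _ → px ; complete = λ py → fzero , unique py }

  Enumeration-∪ : ∀ {P Q N M} → Symmetric _≈_ → (∀ {x y} → P x → Q y → ¬ x ≈ y) →
                  Enumeration _≈_ P N → Enumeration _≈_ Q M → Enumeration _≈_ (P ∪ Q) (N + M)
  Enumeration-∪ {P} {Q} {N} {M} sym≈ disjoint EP EQ = record
    { enum = λ i → enum⊎ (splitAt N i) ; injective = inj
    ; sound = λ i → sound⊎ (splitAt N i) ; complete = comp }
    where
      enum⊎ : Fin N ⊎ Fin M → X
      enum⊎ (inj₁ i) = enum EP i
      enum⊎ (inj₂ i) = enum EQ i
      sound⊎ : ∀ s → (P ∪ Q) (enum⊎ s)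
      sound⊎ (inj₁ i) = inj₁ (sound EP i)
      sound⊎ (inj₂ i) = inj₂ (sound EQ i)
      inj⊎ : ∀ s t → enum⊎ s ≈ enum⊎ t → s ≡ t
      inj⊎ (inj₁ i) (inj₁ j) e = cong inj₁ (injective EP e)
      inj⊎ (inj₁ i) (inj₂ j) e = ⊥-elim (disjoint (sound EP i) (sound EQ j) e)
      inj⊎ (inj₂ i) (inj₁ j) e = ⊥-elim (disjoint (sound EP j) (sound EQ i) (sym≈ e))
      inj⊎ (inj₂ i) (inj₂ j) e = cong inj₂ (injective EQ e)
      inj : ∀ {i j} → enum⊎ (splitAt N i) ≈ enum⊎ (splitAt N j) → i ≡ j
      inj {i} {j} e = begin
        i                      ≡⟨ join-splitAt N M i ⟨
        join N M (splitAt N i) ≡⟨ cong (join N M) (inj⊎ (splitAt N i) (splitAt N j) e) ⟩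
        join N M (splitAt N j) ≡⟨ join-splitAt N M j ⟩
        j                      ∎
        where open ≡-Reasoning
      at : ∀ s {x} → enum⊎ s ≈ x → ∃ λ i → enum⊎ (splitAt N i) ≈ x
      at s e = join N M s , subst (λ t → enum⊎ t ≈ _) (sym (splitAt-join N M s)) e
      comp : ∀ {x} → (P ∪ Q) x → ∃ λ i → enum⊎ (splitAt N i) ≈ x
      comp (inj₁ p) = let i , e = complete EP p in at (inj₁ i) e
      comp (inj₂ q) = let i , e = complete EQ q in at (inj₂ i) e

module _ {X Y : Set} {_≈X_ : Rel X 0ℓ} {_≈Y_ : Rel Y 0ℓ} {P : Pred X 0ℓ} {Q : Pred Y 0ℓ} where

  Enumeration-image : ∀ {N} (g : X → Y) → (∀ {x x′} → x ≈X x′ → g x ≈Y g x′) → Transitive _≈Y_ →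
    (∀ {x x′} → P x → P x′ → g x ≈Y g x′ → x ≈X x′) → (∀ {x} → P x → Q (g x)) →
    (∀ {y} → Q y → ∃ λ x → P x × g x ≈Y y) →
    Enumeration _≈X_ P N → Enumeration _≈Y_ Q N
  Enumeration-image g g-cong trans≈ g-injective g-sound g-complete E = record
    { enum = λ i → g (enum E i)
    ; injective = λ e → injective E (g-injective (sound E _) (sound E _) e)
    ; sound = λ i → g-sound (sound E i)
    ; complete = λ q → let x , px , gx≈y = g-complete q ; i , e = complete E px
                       in i , trans≈ (g-cong e) gx≈y }

Enumeration⇒List : ∀ {X : Set} {P : Pred X 0ℓ} {N} → Enumeration _≡_ P N →
  Σ (List X) λ L → Unique L × (∀ x → (x ∈ L) ⇔ P x) × length L ≡ N
Enumeration⇒List {P = P} E =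
  List.tabulate (enum E) , tabulate⁺ (injective E) , membership , length-tabulate (enum E)
  where
    membership : ∀ x → (x ∈ List.tabulate (enum E)) ⇔ P x
    membership x = mk⇔ (λ x∈ → let i , e = ∈-tabulate⁻ x∈ in subst P (sym e) (sound E i))
                       (λ px → let i , e = complete E px in subst (_∈ _) e (∈-tabulate⁺ i))

count : {P : Pred (Fin n) 0ℓ} → Decidable P → ℕ
count {zero} P? = 0
count {suc n} P? with P? fzero
... | yes _ = suc (count (P? ∘ fsuc))
... | no _ = count (P? ∘ fsuc)

count-cong : {P Q : Pred (Fin n) 0ℓ} (P? : Decidable P) (Q? : Decidable Q) → P ≐ Q → count P? ≡ count Q?
count-cong {zero} P? Q? P≐Q = refl
count-cong {suc n} P? Q? (P⊆Q , Q⊆P) with P? fzero | Q? fzero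
... | yes _ | yes _ = cong suc (count-cong (P? ∘ fsuc) (Q? ∘ fsuc) (P⊆Q , Q⊆P))
... | yes p | no ¬q = contradiction (P⊆Q p) ¬q
... | no ¬p | yes q = contradiction (Q⊆P q) ¬p
... | no _ | no _ = count-cong (P? ∘ fsuc) (Q? ∘ fsuc) (P⊆Q , Q⊆P)

count≡0⇒empty : {P : Pred (Fin n) 0ℓ} (P? : Decidable P) → count P? ≡ 0 → ∀ v → ¬ P v
count≡0⇒empty {suc n} P? c v p with P? fzero | v
... | yes _ | _ = contradiction c λ ()
... | no ¬p₀ | fzero = ¬p₀ p
... | no _ | fsuc v′ = count≡0⇒empty (P? ∘ fsuc) c v′ p

count≡suc⇒nonempty : ∀ {P : Pred (Fin n) 0ℓ} {m} (P? : Decidable P) → count P? ≡ suc m → ∃ P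
count≡suc⇒nonempty {suc n} P? c with P? fzero
... | yes p₀ = fzero , p₀
... | no _ = let v , p = count≡suc⇒nonempty (P? ∘ fsuc) c in fsuc v , p

count-empty : {P : Pred (Fin n) 0ℓ} (P? : Decidable P) → (∀ v → ¬ P v) → count P? ≡ 0
count-empty {zero} P? ∄P = refl
count-empty {suc n} P? ∄P with P? fzero
... | yes p₀ = contradiction p₀ (∄P fzero)
... | no _ = count-empty (P? ∘ fsuc) (∄P ∘ fsuc)

count-universal : {P : Pred (Fin n) 0ℓ} (P? : Decidable P) → (∀ v → P v) → count P? ≡ n
count-universal {zero} P? ∀P = refl
count-universal {suc n} P? ∀P with P? fzero
... | yes _ = cong suc (count-universal (P? ∘ fsuc) (∀P ∘ fsuc))
... | no ¬p₀ = contradiction (∀P fzero) ¬p₀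

count-except : {P Q : Pred (Fin n) 0ℓ} (P? : Decidable P) (Q? : Decidable Q) (x : Fin n) → P x → ¬ Q x →
               (∀ {v} → v ≢ x → P v ⇔ Q v) → count P? ≡ suc (count Q?)
count-except {suc n} P? Q? fzero px ¬qx P⇔Q with P? fzero | Q? fzero
... | _ | yes qx = contradiction qx ¬qx
... | no ¬px | _ = contradiction px ¬px
... | yes _ | no _ = cong suc (count-cong (P? ∘ fsuc) (Q? ∘ fsuc)
                       (Equivalence.to (P⇔Q λ ()) , Equivalence.from (P⇔Q λ ())))
count-except {suc n} P? Q? (fsuc x) px ¬qx P⇔Q with P? fzero | Q? fzero
... | yes _ | yes _ = cong suc (count-except (P? ∘ fsuc) (Q? ∘ fsuc) x px ¬qx (P⇔Q ∘ (_∘ fsuc-injective)))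
... | yes p₀ | no ¬q₀ = contradiction (Equivalence.to (P⇔Q λ ()) p₀) ¬q₀
... | no ¬p₀ | yes q₀ = contradiction (Equivalence.from (P⇔Q λ ()) q₀) ¬p₀
... | no _ | no _ = count-except (P? ∘ fsuc) (Q? ∘ fsuc) x px ¬qx (P⇔Q ∘ (_∘ fsuc-injective))

count-below : ∀ t → t ≤ n → count {n} (λ v → toℕ v <? t) ≡ t
count-below {n} zero _ = count-empty {n = n} (λ v → toℕ v <? 0) λ _ ()
count-below {suc n} (suc t) (s≤s t≤n) = cong suc (begin
  count {n} (λ v → suc (toℕ v) <? suc t) ≡⟨ count-cong {n = n} _ _ (s<s⁻¹ , s<s) ⟩
  count {n} (λ v → toℕ v <? t)           ≡⟨ count-below t t≤n ⟩
  t                                      ∎)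
  where open ≡-Reasoning

module _ {A : Set} (_≟_ : DecidableEquality A) where

  count-≡-cong : {f g : Fin n → A} {a : A} → f ≗ g → count (λ v → f v ≟ a) ≡ count (λ v → g v ≟ a)
  count-≡-cong f≗g = count-cong _ _ ((λ {v} → trans (sym (f≗g v))) , (λ {v} → trans (f≗g v)))

  count-≡-except : {f g : Fin n → A} {a : A} (x : Fin n) → f x ≡ a → g x ≢ a →
                   (∀ {v} → v ≢ x → f v ≡ g v) → count (λ v → f v ≟ a) ≡ suc (count (λ v → g v ≟ a))
  count-≡-except x fx≡a gx≢a f≡g = count-except _ _ x fx≡a gx≢a
    λ v≢x → mk⇔ (trans (sym (f≡g v≢x))) (trans (f≡g v≢x))

-- forests t a counts the forests on t + a vertices with a prescribed set of a roots, and
-- constrainedForests u t a the constrained forests with u free vertices, t nonchildren and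
-- a roots left once ρ is deleted.
forests : ℕ → ℕ → ℕ
forests zero a = 1
forests (suc t) a = a * (suc t + a) ^ t

constrainedForests : ℕ → ℕ → ℕ → ℕ
constrainedForests zero t a = forests t a
constrainedForests (suc u) t a = constrainedForests u (suc t) a + constrainedForests u t (suc a)

constrainedForests-closed : ∀ M u t a → u + t + a ≡ M →
  M * suc M * constrainedForests u t a ≡ M ^ t * suc M ^ u * (a * suc M + u)
constrainedForests-closed M zero zero a refl = identity a
  where
    identity : ∀ a → a * suc a * 1 ≡ 1 * 1 * (a * suc a + 0)
    identity = solve-∀
constrainedForests-closed M zero (suc t) a refl = identity (suc t + a) a ((suc t + a) ^ t)
  where
    identity : ∀ M a X → M * suc M * (a * X) ≡ M * X * 1 * (a * suc M + 0)
    identity = solve-∀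
constrainedForests-closed M (suc u) t a size = begin
  M * suc M * (constrainedForests u (suc t) a + constrainedForests u t (suc a))
    ≡⟨ *-distribˡ-+ (M * suc M) (constrainedForests u (suc t) a) _ ⟩
  M * suc M * constrainedForests u (suc t) a + M * suc M * constrainedForests u t (suc a)
    ≡⟨ cong₂ _+_ (constrainedForests-closed M u (suc t) a (trans (cong (_+ a) (+-suc u t)) size))
                 (constrainedForests-closed M u t (suc a) (trans (+-suc (u + t) a) size)) ⟩
  M ^ suc t * suc M ^ u * (a * suc M + u) + M ^ t * suc M ^ u * (suc a * suc M + u)
    ≡⟨ identity M a u (M ^ t) (suc M ^ u) ⟩
  M ^ t * suc M ^ suc u * (a * suc M + suc u) ∎
  where
    open ≡-Reasoning
    identity : ∀ M a u X Y → M * X * Y * (a * suc M + u) + X * Y * (suc a * suc M + u)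
                             ≡ X * (suc M * Y) * (a * suc M + suc u)
    identity = solve-∀

constrainedForests≡forests : ∀ t a → constrainedForests t 0 a ≡ forests t (suc a)
constrainedForests≡forests zero a = refl
constrainedForests≡forests (suc t) a = *-cancelˡ-≡ _ _ (M * suc M) (begin
  M * suc M * constrainedForests (suc t) 0 a
    ≡⟨ constrainedForests-closed M (suc t) 0 a (cong (_+ a) (+-identityʳ (suc t))) ⟩
  1 * suc M ^ suc t * (a * suc M + suc t)
    ≡⟨ identity t a (suc M ^ t) ⟩
  M * suc M * (suc a * suc M ^ t)
    ≡⟨ cong (λ m → M * suc M * (suc a * m ^ t)) (+-suc (suc t) a) ⟨
  M * suc M * forests (suc t) (suc a) ∎)
  where
    open ≡-Reasoning
    M : ℕ
    M = suc t + a
    identity : ∀ t a X → 1 * (suc (suc t + a) * X) * (a * suc (suc t + a) + suc t)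
                         ≡ (suc t + a) * suc (suc t + a) * (suc a * X)
    identity = solve-∀

data Shape : Set where
  absent root inner : Shape

-- Roles relative to a distinguished root ρ: child and nonchild vertices must and must not
-- have parent ρ, free ones are undecided.
data Role : Set where
  plain : Shape → Role
  child nonchild : Role

pattern free = plain inner

_≟ˢ_ : DecidableEquality Shape
absent ≟ˢ absent = yes refl
absent ≟ˢ root = no λ ()
absent ≟ˢ inner = no λ ()
root ≟ˢ absent = no λ ()
root ≟ˢ root = yes refl
root ≟ˢ inner = no λ ()
inner ≟ˢ absent = no λ ()
inner ≟ˢ root = no λ ()
inner ≟ˢ inner = yes refl

_≟ᴿ_ : DecidableEquality Role
plain s ≟ᴿ plain s′ = map′ (cong plain) (λ { refl → refl }) (s ≟ˢ s′)
plain _ ≟ᴿ child = no λ ()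
plain _ ≟ᴿ nonchild = no λ ()
child ≟ᴿ plain _ = no λ ()
child ≟ᴿ child = yes refl
child ≟ᴿ nonchild = no λ ()
nonchild ≟ᴿ plain _ = no λ ()
nonchild ≟ᴿ child = no λ ()
nonchild ≟ᴿ nonchild = yes refl

shape : Role → Shape
shape (plain s) = s
shape child = inner
shape nonchild = inner

promote : Role → Shape
promote (plain s) = s
promote child = root
promote nonchild = inner

#inner #roots : (Fin n → Shape) → ℕ
#inner σ = count (λ v → σ v ≟ˢ inner)
#roots σ = count (λ v → σ v ≟ˢ root)

#free : (Fin n → Role) → ℕ
#free τ = count (λ v → τ v ≟ᴿ free)

-- Forests are given by parent functions; fixing absent vertices makes this encoding unique.
record IsForest (σ : Fin n → Shape) (p : Fin n → Fin n) : Set where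
  field
    fixed    : ∀ v → σ v ≢ inner → p v ≡ v
    closed   : ∀ v → σ v ≡ inner → σ (p v) ≢ absent
    rank     : Fin n → ℕ
    descends : ∀ v → σ v ≡ inner → rank (p v) < rank v

IsForest-cong : ∀ {σ σ′ : Fin n → Shape} {p} → σ ≗ σ′ → IsForest σ p → IsForest σ′ p
IsForest-cong σ≗σ′ F = record
  { fixed = λ v ¬inner → IsForest.fixed F v (¬inner ∘ trans (sym (σ≗σ′ v)))
  ; closed = λ v v-inner → IsForest.closed F v (trans (σ≗σ′ v) v-inner) ∘ trans (σ≗σ′ _)
  ; rank = IsForest.rank F
  ; descends = λ v v-inner → IsForest.descends F v (trans (σ≗σ′ v) v-inner) }

record IsConstrainedForest (ρ : Fin n) (τ : Fin n → Role) (p : Fin n → Fin n) : Set where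
  field
    forest      : IsForest (shape ∘ τ) p
    children    : ∀ v → τ v ≡ child → p v ≡ ρ
    nonchildren : ∀ v → τ v ≡ nonchild → p v ≢ ρ

open IsConstrainedForest

_[_]≔_ : {A : Set} → (Fin n → A) → Fin n → A → Fin n → A
f [ x ]≔ a = updateAt f x (λ _ → a)

≔-self : ∀ {A : Set} (f : Fin n → A) x {a} → (f [ x ]≔ a) x ≡ a
≔-self f x = updateAt-updates x f

≔-other : ∀ {A : Set} (f : Fin n → A) {x v a} → v ≢ x → (f [ x ]≔ a) v ≡ f v
≔-other f {x} v≢x = updateAt-minimal _ x f v≢x

-- Deleting ρ turns its prescribed children into roots.
reroot : Fin n → (Fin n → Role) → Fin n → Shape
reroot ρ τ = (promote ∘ τ) [ ρ ]≔ absent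

reroot-self : ∀ ρ (τ : Fin n → Role) → reroot ρ τ ρ ≡ absent
reroot-self ρ τ = ≔-self (promote ∘ τ) ρ

reroot-other : ∀ {ρ v} (τ : Fin n → Role) → v ≢ ρ → reroot ρ τ v ≡ promote (τ v)
reroot-other τ = ≔-other (promote ∘ τ)

ifChild : {A : Set} → Role → A → A → A
ifChild child x _ = x
ifChild (plain _) _ y = y
ifChild nonchild _ y = y

attach : Fin n → (Fin n → Role) → (Fin n → Fin n) → Fin n → Fin n
attach ρ τ q v = ifChild (τ v) ρ (q v)

detach : (Fin n → Role) → (Fin n → Fin n) → Fin n → Fin n
detach τ p v = ifChild (τ v) v (p v)

inner-role : ∀ r → shape r ≡ inner → r ≢ free → r ≡ child ⊎ r ≡ nonchild
inner-role (plain .inner) refl r≢free = contradiction refl r≢free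
inner-role child _ _ = inj₁ refl
inner-role nonchild _ _ = inj₂ refl

promote-inner : ∀ r → r ≢ free → promote r ≡ inner → r ≡ nonchild
promote-inner (plain .inner) r≢free refl = contradiction refl r≢free
promote-inner nonchild _ _ = refl

promote-absent : ∀ r → promote r ≡ absent → shape r ≡ absent
promote-absent (plain .absent) refl = refl

shape-absent : ∀ r → shape r ≡ absent → promote r ≡ absent
shape-absent (plain .absent) refl = refl

module Decided {ρ : Fin n} {τ : Fin n → Role} (ρ-root : τ ρ ≡ plain root) (no-free : ∀ v → τ v ≢ free) where

  open IsForest

  inner-role′ : ∀ v → shape (τ v) ≡ inner → τ v ≡ child ⊎ τ v ≡ nonchild
  inner-role′ v v-inner = inner-role (τ v) v-inner (no-free v)

  inner⇒≢ρ : ∀ {v} → shape (τ v) ≡ inner → v ≢ ρ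
  inner⇒≢ρ v-inner refl with () ← trans (sym (cong shape ρ-root)) v-inner

  reroot-inner : ∀ v → reroot ρ τ v ≡ inner → τ v ≡ nonchild
  reroot-inner v v-inner with v ≟ ρ
  ... | yes refl = case trans (sym (reroot-self ρ τ)) v-inner of λ ()
  ... | no v≢ρ = promote-inner (τ v) (no-free v) (trans (sym (reroot-other τ v≢ρ)) v-inner)

  module _ {q} (Q : IsForest (reroot ρ τ) q) where

    nonchild-parent : ∀ {v} → τ v ≡ nonchild → q v ≢ ρ × shape (τ (q v)) ≢ absent × rank Q (q v) < rank Q v
    nonchild-parent {v} nc = qv≢ρ , qv-present , descends Q v v-inner
      where
        v-inner : reroot ρ τ v ≡ inner
        v-inner = trans (reroot-other τ (inner⇒≢ρ (cong shape nc))) (cong promote nc)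
        qv≢ρ : q v ≢ ρ
        qv≢ρ refl = closed Q v v-inner (reroot-self ρ τ)
        qv-present : shape (τ (q v)) ≢ absent
        qv-present qv-absent = closed Q v v-inner (trans (reroot-other τ qv≢ρ) (shape-absent (τ (q v)) qv-absent))

    lifted-rank : Fin n → ℕ
    lifted-rank = (suc ∘ rank Q) [ ρ ]≔ 0

    attach-forest : IsConstrainedForest ρ τ (attach ρ τ q)
    attach-forest = record
      { forest = record { fixed = fixed′ ; closed = closed′ ; rank = lifted-rank ; descends = descends′ }
      ; children = λ v c → subst (λ r → ifChild r ρ (q v) ≡ ρ) (sym c) refl
      ; nonchildren = λ v nc → subst (λ r → ifChild r ρ (q v) ≢ ρ) (sym nc) (proj₁ (nonchild-parent nc)) }
      where
        fixed′ : ∀ v → shape (τ v) ≢ inner → attach ρ τ q v ≡ v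
        fixed′ v ¬inner with τ v in eq
        ... | child = contradiction refl ¬inner
        ... | nonchild = contradiction refl ¬inner
        ... | plain s = fixed Q v λ v-inner → ¬inner (cong shape (trans (sym eq) (reroot-inner v v-inner)))
        closed′ : ∀ v → shape (τ v) ≡ inner → shape (τ (attach ρ τ q v)) ≢ absent
        closed′ v v-inner with τ v in eq | inner-role′ v v-inner
        ... | child | _ = λ ρ-absent → case trans (sym (cong shape ρ-root)) ρ-absent of λ ()
        ... | nonchild | _ = proj₁ (proj₂ (nonchild-parent eq))
        ... | plain _ | inj₁ ()
        ... | plain _ | inj₂ ()
        descends′ : ∀ v → shape (τ v) ≡ inner → lifted-rank (attach ρ τ q v) < lifted-rank v
        descends′ v v-inner with τ v in eq | inner-role′ v v-inner
        ... | child | _ = subst₂ _<_ (sym (≔-self _ ρ)) (sym (≔-other _ (inner⇒≢ρ v-inner))) (s≤s z≤n)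
        ... | nonchild | _ = let qv≢ρ , _ , r< = nonchild-parent eq in
          subst₂ _<_ (sym (≔-other _ qv≢ρ)) (sym (≔-other _ (inner⇒≢ρ v-inner))) (s≤s r<)
        ... | plain _ | inj₁ ()
        ... | plain _ | inj₂ ()

  detach-forest : ∀ {p} → IsConstrainedForest ρ τ p → IsForest (reroot ρ τ) (detach τ p)
  detach-forest {p} P = record { fixed = fixed′ ; closed = closed′ ; rank = rank F ; descends = descends′ }
    where
      F : IsForest (shape ∘ τ) p
      F = forest P
      fixed′ : ∀ v → reroot ρ τ v ≢ inner → detach τ p v ≡ v
      fixed′ v ¬inner with τ v in eq
      ... | child = refl
      ... | nonchild = contradiction (trans (reroot-other τ (inner⇒≢ρ (cong shape eq))) (cong promote eq)) ¬inner
      ... | plain s = fixed F v λ v-inner → no-free v (trans eq (cong plain (trans (sym (cong shape eq)) v-inner)))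
      closed′ : ∀ v → reroot ρ τ v ≡ inner → reroot ρ τ (detach τ p v) ≢ absent
      closed′ v v-inner with reroot-inner v v-inner
      ... | nc rewrite nc = λ pv-absent → closed F v (cong shape nc)
            (promote-absent (τ (p v)) (trans (sym (reroot-other τ (nonchildren P v nc))) pv-absent))
      descends′ : ∀ v → reroot ρ τ v ≡ inner → rank F (detach τ p v) < rank F v
      descends′ v v-inner with reroot-inner v v-inner
      ... | nc rewrite nc = descends F v (cong shape nc)

  attach-detach : ∀ {p} → IsConstrainedForest ρ τ p → attach ρ τ (detach τ p) ≗ p
  attach-detach P v with τ v in eq
  ... | child = sym (children P v eq)
  ... | nonchild = refl
  ... | plain _ = refl

  attach-injective : ∀ {q q′} → IsForest (reroot ρ τ) q → IsForest (reroot ρ τ) q′ →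
                     attach ρ τ q ≗ attach ρ τ q′ → q ≗ q′
  attach-injective {q} {q′} Q Q′ e v with τ v in eq | e v
  ... | nonchild | ev = ev
  ... | plain _ | ev = ev
  ... | child | _ = trans (fixed Q v v-root) (sym (fixed Q′ v v-root))
    where
      v-root : reroot ρ τ v ≢ inner
      v-root v-inner = case trans (sym eq) (reroot-inner v v-inner) of λ ()

  attach-cong : ∀ {q q′} → q ≗ q′ → attach ρ τ q ≗ attach ρ τ q′
  attach-cong {q} {q′} e v = cong (ifChild (τ v) ρ) (e v)

  decided-enumeration : ∀ {N} → Enumeration _≗_ (IsForest (reroot ρ τ)) N →
                        Enumeration _≗_ (IsConstrainedForest ρ τ) N
  decided-enumeration = Enumeration-image (attach ρ τ) attach-cong (λ e e′ v → trans (e v) (e′ v))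
    attach-injective attach-forest (λ P → detach τ _ , detach-forest P , attach-detach P)

reroot-cong : ∀ (ρ : Fin n) {τ τ′} v → promote (τ v) ≡ promote (τ′ v) → reroot ρ τ v ≡ reroot ρ τ′ v
reroot-cong ρ {τ} {τ′} v e with v ≟ ρ
... | yes refl = trans (reroot-self ρ τ) (sym (reroot-self ρ τ′))
... | no v≢ρ = trans (reroot-other τ v≢ρ) (trans e (sym (reroot-other τ′ v≢ρ)))

module DecideVertex {ρ x : Fin n} {τ : Fin n → Role} (ρ-root : τ ρ ≡ plain root) (x-free : τ x ≡ free) where

  x≢ρ : x ≢ ρ
  x≢ρ refl = case trans (sym x-free) ρ-root of λ ()

  update-self : ∀ r → (τ [ x ]≔ r) x ≡ r
  update-self r = ≔-self τ x

  update-other : ∀ r {v} → v ≢ x → (τ [ x ]≔ r) v ≡ τ v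
  update-other r = ≔-other τ

  shape-update : ∀ r → shape r ≡ inner → shape ∘ (τ [ x ]≔ r) ≗ shape ∘ τ
  shape-update r r-inner v with v ≟ x
  ... | yes refl = trans (cong shape (update-self r)) (trans r-inner (sym (cong shape x-free)))
  ... | no v≢x = cong shape (update-other r v≢x)

  constrained-≢x : ∀ {v r} → τ v ≡ r → r ≢ free → v ≢ x
  constrained-≢x τv≡r r≢free refl = r≢free (trans (sym τv≡r) x-free)

  relax : ∀ r {p} → shape r ≡ inner → IsConstrainedForest ρ (τ [ x ]≔ r) p → IsConstrainedForest ρ τ p
  relax r r-inner P = record
    { forest = IsForest-cong (shape-update r r-inner) (forest P)
    ; children = λ v c → children P v (trans (update-other r (constrained-≢x c λ ())) c)
    ; nonchildren = λ v nc → nonchildren P v (trans (update-other r (constrained-≢x nc λ ())) nc) }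

  commit : ∀ r {p} → shape r ≡ inner → IsConstrainedForest ρ τ p →
           (r ≡ child → p x ≡ ρ) → (r ≡ nonchild → p x ≢ ρ) → IsConstrainedForest ρ (τ [ x ]≔ r) p
  commit r r-inner P child-ok nonchild-ok = record
    { forest = IsForest-cong (sym ∘ shape-update r r-inner) (forest P)
    ; children = λ v c → case v ≟ x of λ
        { (yes refl) → child-ok (trans (sym (update-self r)) c)
        ; (no v≢x) → children P v (trans (sym (update-other r v≢x)) c) }
    ; nonchildren = λ v nc → case v ≟ x of λ
        { (yes refl) → nonchild-ok (trans (sym (update-self r)) nc)
        ; (no v≢x) → nonchildren P v (trans (sym (update-other r v≢x)) nc) } }

  split : ∀ {p} → IsConstrainedForest ρ τ p →
          IsConstrainedForest ρ (τ [ x ]≔ nonchild) p ⊎ IsConstrainedForest ρ (τ [ x ]≔ child) p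
  split {p} P with p x ≟ ρ
  ... | yes px≡ρ = inj₂ (commit child refl P (λ _ → px≡ρ) λ ())
  ... | no px≢ρ = inj₁ (commit nonchild refl P (λ ()) λ _ → px≢ρ)

  split-disjoint : ∀ {p q} → IsConstrainedForest ρ (τ [ x ]≔ nonchild) p →
                   IsConstrainedForest ρ (τ [ x ]≔ child) q → ¬ p ≗ q
  split-disjoint P Q p≗q = nonchildren P x (update-self nonchild) (trans (p≗q x) (children Q x (update-self child)))

  #free-update : ∀ r → r ≢ free → #free τ ≡ suc (#free (τ [ x ]≔ r))
  #free-update r r≢free = count-≡-except _≟ᴿ_ x x-free (r≢free ∘ trans (sym (update-self r)))
                            (sym ∘ update-other r)

  reroot-update-other : ∀ r {v} → v ≢ x → reroot ρ (τ [ x ]≔ r) v ≡ reroot ρ τ v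
  reroot-update-other r {v} v≢x = reroot-cong ρ {τ [ x ]≔ r} {τ} v (cong promote (update-other r v≢x))

  reroot-update-self : ∀ r → reroot ρ (τ [ x ]≔ r) x ≡ promote r
  reroot-update-self r = trans (reroot-other (τ [ x ]≔ r) x≢ρ) (cong promote (update-self r))

  reroot-free : reroot ρ τ x ≡ inner
  reroot-free = trans (reroot-other τ x≢ρ) (cong promote x-free)

  reroot-nonchild : reroot ρ (τ [ x ]≔ nonchild) ≗ reroot ρ τ
  reroot-nonchild v with v ≟ x
  ... | yes refl = trans (reroot-update-self nonchild) (sym reroot-free)
  ... | no v≢x = reroot-update-other nonchild v≢x

  #inner-child : #inner (reroot ρ τ) ≡ suc (#inner (reroot ρ (τ [ x ]≔ child)))
  #inner-child = count-≡-except _≟ˢ_ x reroot-free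
    (λ e → case trans (sym (reroot-update-self child)) e of λ ()) (sym ∘ reroot-update-other child)

  #roots-child : #roots (reroot ρ (τ [ x ]≔ child)) ≡ suc (#roots (reroot ρ τ))
  #roots-child = count-≡-except _≟ˢ_ x (reroot-update-self child)
    (λ e → case trans (sym reroot-free) e of λ ()) (reroot-update-other child)

ForestEnumerations : ℕ → ℕ → Set
ForestEnumerations n M = ∀ t a (σ : Fin n → Shape) → t + a ≡ M → #inner σ ≡ t → #roots σ ≡ a →
                         Enumeration _≗_ (IsForest σ) (forests t a)

constrained-enumeration : ∀ {M} → ForestEnumerations n M →
  ∀ u t a {ρ} {τ : Fin n → Role} → τ ρ ≡ plain root →
  #free τ ≡ u → #inner (reroot ρ τ) ≡ u + t → #roots (reroot ρ τ) ≡ a → u + t + a ≡ M →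
  Enumeration _≗_ (IsConstrainedForest ρ τ) (constrainedForests u t a)
constrained-enumeration forests-enum zero t a ρ-root #free≡ #inner≡ #roots≡ size =
  Decided.decided-enumeration ρ-root (count≡0⇒empty _ #free≡) (forests-enum t a _ size #inner≡ #roots≡)
constrained-enumeration {n} forests-enum (suc u) t a {ρ} {τ} ρ-root #free≡ #inner≡ #roots≡ size =
  Enumeration-≐ ([ relax nonchild refl , relax child refl ] , split)
    (Enumeration-∪ (λ e v → sym (e v)) split-disjoint
      (constrained-enumeration forests-enum u (suc t) a (ρ-root′ nonchild)
        (suc-injective (trans (sym (#free-update nonchild λ ())) #free≡))
        (trans (count-≡-cong _≟ˢ_ reroot-nonchild) (trans #inner≡ (sym (+-suc u t))))
        (trans (count-≡-cong _≟ˢ_ reroot-nonchild) #roots≡)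
        (trans (cong (_+ a) (+-suc u t)) size))
      (constrained-enumeration forests-enum u t (suc a) (ρ-root′ child)
        (suc-injective (trans (sym (#free-update child λ ())) #free≡))
        (suc-injective (trans (sym #inner-child) #inner≡))
        (trans #roots-child (cong suc #roots≡))
        (trans (+-suc (u + t) a) size)))
  where
    x : Fin n
    x = proj₁ (count≡suc⇒nonempty (λ v → τ v ≟ᴿ free) #free≡)
    open DecideVertex {x = x} {τ} ρ-root (proj₂ (count≡suc⇒nonempty (λ v → τ v ≟ᴿ free) #free≡))
    ρ-root′ : ∀ r → (τ [ x ]≔ r) ρ ≡ plain root
    ρ-root′ r = trans (update-other r (x≢ρ ∘ sym)) ρ-root

present-nonroot : ∀ s → s ≢ absent → s ≢ root → s ≡ inner
present-nonroot absent s≢absent _ = contradiction refl s≢absent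
present-nonroot root _ s≢root = contradiction refl s≢root
present-nonroot inner _ _ = refl

rootless-forest : ∀ {σ : Fin n → Shape} {p} → IsForest σ p → (∀ v → σ v ≢ root) → ∀ v → σ v ≢ inner
rootless-forest {σ = σ} {p} F no-root v = descend v (<-wellFounded (IsForest.rank F v))
  where
    descend : ∀ v → Acc _<_ (IsForest.rank F v) → σ v ≢ inner
    descend v (acc smaller) v-inner = descend (p v) (smaller (IsForest.descends F v v-inner))
      (present-nonroot (σ (p v)) (IsForest.closed F v v-inner) (no-root (p v)))

trivial-forest : ∀ {σ : Fin n → Shape} → (∀ v → σ v ≢ inner) → IsForest σ (λ v → v)
trivial-forest no-inner = record
  { fixed = λ _ _ → refl ; closed = λ v v-inner → contradiction v-inner (no-inner v)
  ; rank = λ _ → 0 ; descends = λ v v-inner → contradiction v-inner (no-inner v) }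

module PickRoot {σ : Fin n → Shape} {ρ} (ρ-root : σ ρ ≡ root) where

  unconstrained : ∀ {p} → IsForest σ p → IsConstrainedForest ρ (plain ∘ σ) p
  unconstrained F = record { forest = F ; children = λ _ () ; nonchildren = λ _ () }

  #free-plain : #free (plain ∘ σ) ≡ #inner σ
  #free-plain = count-cong (λ v → plain (σ v) ≟ᴿ free) (λ v → σ v ≟ˢ inner) (cong shape , cong plain)

  #inner-reroot : #inner (reroot ρ (plain ∘ σ)) ≡ #inner σ
  #inner-reroot = count-cong (λ v → reroot ρ (plain ∘ σ) v ≟ˢ inner) (λ v → σ v ≟ˢ inner)
                    (reroot-inner , inner-reroot)
    where
      reroot-inner : ∀ {v} → reroot ρ (plain ∘ σ) v ≡ inner → σ v ≡ inner
      reroot-inner {v} v-inner with v ≟ ρ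
      ... | yes refl = case trans (sym (reroot-self ρ (plain ∘ σ))) v-inner of λ ()
      ... | no v≢ρ = trans (sym (reroot-other (plain ∘ σ) v≢ρ)) v-inner
      inner-reroot : ∀ {v} → σ v ≡ inner → reroot ρ (plain ∘ σ) v ≡ inner
      inner-reroot {v} σv-inner with v ≟ ρ
      ... | yes refl = case trans (sym ρ-root) σv-inner of λ ()
      ... | no v≢ρ = trans (reroot-other (plain ∘ σ) v≢ρ) σv-inner

  #roots-reroot : #roots σ ≡ suc (#roots (reroot ρ (plain ∘ σ)))
  #roots-reroot = count-≡-except _≟ˢ_ ρ ρ-root (λ e → case trans (sym (reroot-self ρ (plain ∘ σ))) e of λ ())
                    (λ v≢ρ → sym (reroot-other (plain ∘ σ) v≢ρ))

forest-enumeration : ∀ M → ForestEnumerations n M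
forest-enumeration M zero a σ _ #inner≡ _ =
  Enumeration-singleton (trivial-forest no-inner) λ F v → sym (IsForest.fixed F v (no-inner v))
  where
    no-inner : ∀ v → σ v ≢ inner
    no-inner = count≡0⇒empty _ #inner≡
forest-enumeration M (suc t) zero σ _ #inner≡ #roots≡ =
  Enumeration-empty λ p F → let x , x-inner = count≡suc⇒nonempty _ #inner≡ in
    rootless-forest F (count≡0⇒empty _ #roots≡) x x-inner
forest-enumeration zero (suc t) (suc a) σ () _ _
forest-enumeration {n} (suc M) (suc t) (suc a) σ size #inner≡ #roots≡ =
  subst (Enumeration _≗_ (IsForest σ)) (constrainedForests≡forests (suc t) a)
    (Enumeration-≐ (IsConstrainedForest.forest , unconstrained)
      (constrained-enumeration (forest-enumeration M) (suc t) 0 a (cong plain ρ-root)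
        (trans #free-plain #inner≡)
        (trans #inner-reroot (trans #inner≡ (sym (+-identityʳ (suc t)))))
        (suc-injective (trans (sym #roots-reroot) #roots≡))
        (suc-injective (begin
          suc (suc t + 0 + a) ≡⟨ cong (λ m → suc (m + a)) (+-identityʳ (suc t)) ⟩
          suc (suc t + a)     ≡⟨ +-suc (suc t) a ⟨
          suc t + suc a       ≡⟨ size ⟩
          suc M               ∎))))
  where
    open ≡-Reasoning
    ρ : Fin n
    ρ = proj₁ (count≡suc⇒nonempty (λ v → σ v ≟ˢ root) #roots≡)
    ρ-root : σ ρ ≡ root
    ρ-root = proj₂ (count≡suc⇒nonempty (λ v → σ v ≟ˢ root) #roots≡)
    open PickRoot {σ = σ} ρ-root

module _ {A : EdgeSet n} where

  _◅◅_ : ∀ {u v w} → Walk A u v → Walk A v w → Walk A u w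
  here ◅◅ q = q
  step e p ◅◅ q = step e (p ◅◅ q)

  reverseWalk : (∀ {u v} → Adj A u v → Adj A v u) → ∀ {u v} → Walk A u v → Walk A v u
  reverseWalk sym-A here = here
  reverseWalk sym-A (step e p) = reverseWalk sym-A p ◅◅ step (sym-A e) here

  cycle-neighbours : ∀ {m c} → IsCycle A m c → ∀ k →
    ∃₂ λ k⁻ k⁺ → k⁻ ≢ k⁺ × Adj A (c k⁻) (c k) × Adj A (c k) (c k⁺)
  cycle-neighbours (_ , edge , close) fzero = _ , _ , (λ ()) , close , edge fzero
  cycle-neighbours (_ , edge , close) (fsuc i) with view i
  ... | ‵fromℕ = _ , _ , (λ ()) , edge i , close
  ... | ‵inj₁ {i = j} _ = _ , _ , ≢ , edge (inject₁ j) , edge (fsuc j)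
    where
      ≢ : inject₁ (inject₁ j) ≢ fsuc (fsuc j)
      ≢ e = <-irrefl (trans (sym (toℕ-inject₁ j)) (trans (sym (toℕ-inject₁ (inject₁ j))) (cong toℕ e)))
                     (<-trans (n<1+n _) (n<1+n _))

argmax : ∀ {m} (f : Fin (suc m) → ℕ) → ∃ λ k → ∀ i → f i ≤ f k
argmax {zero} f = fzero , λ { fzero → ≤-refl }
argmax {suc m} f with argmax (f ∘ fsuc) | ≤-total (f fzero) (f (fsuc (proj₁ (argmax (f ∘ fsuc)))))
... | k , max | inj₁ f0≤ = fsuc k , λ { fzero → f0≤ ; (fsuc i) → max i }
... | k , max | inj₂ ≤f0 = fzero , λ { fzero → ≤-refl ; (fsuc i) → ≤-trans (max i) ≤f0 }

record IsParentFunction (r : Fin n) (p : Fin n → Fin n) : Set where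
  field
    root-fixed : p r ≡ r
    rank       : Fin n → ℕ
    descends   : ∀ v → v ≢ r → rank (p v) < rank v

  moving⇒nonroot : ∀ {v w} → p v ≡ w → v ≢ w → v ≢ r
  moving⇒nonroot refl v≢pv refl = v≢pv (sym root-fixed)

  moves : ∀ {v w} → p v ≡ w → v ≢ w → rank w < rank v
  moves {v} refl v≢pv = descends v (moving⇒nonroot refl v≢pv)

  p≢id : ∀ {v} → v ≢ r → p v ≢ v
  p≢id {v} v≢r pv≡v = <-irrefl (cong rank pv≡v) (descends v v≢r)

open IsParentFunction

ParentEdge : (Fin n → Fin n) → Fin n → Fin n → Set
ParentEdge p u v = u ≢ v × (p u ≡ v ⊎ p v ≡ u)

isParentEdge : (Fin n → Fin n) → Fin n → Fin n → Bool
isParentEdge p u v = not ⌊ u ≟ v ⌋ ∧ (⌊ p u ≟ v ⌋ ∨ ⌊ p v ≟ u ⌋)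

edgesOf : (Fin n → Fin n) → EdgeSet n
edgesOf p = tabulate λ u → tabulate (isParentEdge p u)

T-injective : ∀ {a b} → (T a → T b) → (T b → T a) → a ≡ b
T-injective {false} {false} _ _ = refl
T-injective {false} {true} _ b⇒a = ⊥-elim (b⇒a tt)
T-injective {true} {false} a⇒b _ = ⊥-elim (a⇒b tt)
T-injective {true} {true} _ _ = refl

EdgeSet-ext : ∀ {A B : EdgeSet n} → (∀ u v → Adj A u v ⇔ Adj B u v) → A ≡ B
EdgeSet-ext {A = A} {B} same = begin
  A                    ≡⟨ tabulate∘lookup A ⟨
  tabulate (lookup A)  ≡⟨ tabulate-cong rows ⟩
  tabulate (lookup B)  ≡⟨ tabulate∘lookup B ⟩
  B                    ∎
  where
    open ≡-Reasoning
    open Equivalence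
    rows : ∀ u → lookup A u ≡ lookup B u
    rows u = begin
      lookup A u                       ≡⟨ tabulate∘lookup (lookup A u) ⟨
      tabulate (lookup (lookup A u))   ≡⟨ tabulate-cong (λ v → T-injective (to (same u v)) (from (same u v))) ⟩
      tabulate (lookup (lookup B u))   ≡⟨ tabulate∘lookup (lookup B u) ⟩
      lookup B u                       ∎

edgesOf-cong : ∀ {p q : Fin n → Fin n} → p ≗ q → edgesOf p ≡ edgesOf q
edgesOf-cong p≗q = tabulate-cong λ u → tabulate-cong λ v →
  cong₂ (λ pu pv → not ⌊ u ≟ v ⌋ ∧ (⌊ pu ≟ v ⌋ ∨ ⌊ pv ≟ u ⌋)) (p≗q u) (p≗q v)

Adj-edgesOf : ∀ (p : Fin n → Fin n) {u v} → Adj (edgesOf p) u v ⇔ ParentEdge p u v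
Adj-edgesOf p {u} {v} = mk⇔
  (λ adj → let u≢v , up-or-down = Equivalence.to (T-∧ {not (⌊ d₁ ⌋)}) (subst T entry adj) in
     toWitnessFalse {a? = d₁} u≢v ,
     map-⊎ (toWitness {a? = d₂}) (toWitness {a? = d₃}) (Equivalence.to (T-∨ {⌊ d₂ ⌋}) up-or-down))
  (λ (u≢v , up-or-down) → subst T (sym entry) (Equivalence.from (T-∧ {not ⌊ d₁ ⌋})
     (fromWitnessFalse {a? = d₁} u≢v ,
      Equivalence.from (T-∨ {⌊ d₂ ⌋}) (map-⊎ (fromWitness {a? = d₂}) (fromWitness {a? = d₃}) up-or-down))))
  where
    d₁ : Dec (u ≡ v)
    d₁ = u ≟ v
    d₂ : Dec (p u ≡ v)
    d₂ = p u ≟ v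
    d₃ : Dec (p v ≡ u)
    d₃ = p v ≟ u
    entry : lookup (lookup (edgesOf p) u) v ≡ isParentEdge p u v
    entry = trans (cong (λ row → lookup row v) (lookup∘tabulate _ u)) (lookup∘tabulate _ v)

module _ {r : Fin n} {p : Fin n → Fin n} (P : IsParentFunction r p) where

  edgesOf-simple : IsSimple (edgesOf p)
  edgesOf-simple = (λ u v adj → let u≢v , e = Equivalence.to (Adj-edgesOf p) adj in
                                  Equivalence.from (Adj-edgesOf p) ((u≢v ∘ sym) , swap e))
                 , (λ u adj → proj₁ (Equivalence.to (Adj-edgesOf p) adj) refl)

  edgesOf-parent : ∀ {v} → v ≢ r → Adj (edgesOf p) v (p v)
  edgesOf-parent v≢r = Equivalence.from (Adj-edgesOf p) (p≢id P v≢r ∘ sym , inj₁ refl)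

  edgesOf-child : ∀ {c} → Adj (edgesOf p) r c → p c ≡ r
  edgesOf-child adj with Equivalence.to (Adj-edgesOf p) adj
  ... | r≢c , inj₁ pr≡c = contradiction (trans (sym (root-fixed P)) pr≡c) r≢c
  ... | _ , inj₂ pc≡r = pc≡r

  walk-to-root : ∀ v → Walk (edgesOf p) v r
  walk-to-root v = climb v (<-wellFounded (rank P v))
    where
      climb : ∀ v → Acc _<_ (rank P v) → Walk (edgesOf p) v r
      climb v (acc smaller) with v ≟ r
      ... | yes refl = here
      ... | no v≢r = step (edgesOf-parent v≢r) (climb (p v) (smaller (descends P v v≢r)))

  edgesOf-connected : Connected (edgesOf p)
  edgesOf-connected u v = walk-to-root u ◅◅ reverseWalk (proj₁ edgesOf-simple _ _) (walk-to-root v)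

  edge-below : ∀ {a b} → Adj (edgesOf p) a b → rank P a ≤ rank P b → p b ≡ a
  edge-below adj a≤b with Equivalence.to (Adj-edgesOf p) adj
  ... | a≢b , inj₁ pa≡b = contradiction a≤b (<⇒≱ (moves P pa≡b a≢b))
  ... | _ , inj₂ pb≡a = pb≡a

  edgesOf-acyclic : Acyclic (edgesOf p)
  edgesOf-acyclic m c cycle@(c-injective , _) with argmax (rank P ∘ c)
  ... | k , max with cycle-neighbours {A = edgesOf p} cycle k
  ...   | k⁻ , k⁺ , k⁻≢k⁺ , e⁻ , e⁺ = k⁻≢k⁺ (c-injective (trans (sym (edge-below e⁻ (max k⁻)))
                                                                  (edge-below (proj₁ edgesOf-simple _ _ e⁺) (max k⁺))))

  edgesOf-isSpanningTree : IsSpanningTree (edgesOf p)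
  edgesOf-isSpanningTree = edgesOf-simple , edgesOf-connected , edgesOf-acyclic

edgesOf-injective : ∀ {r : Fin n} {p q} → IsParentFunction r p → IsParentFunction r q →
                    edgesOf p ≡ edgesOf q → p ≗ q
edgesOf-injective {r = r} {p} {q} P Q same v = agree v (<-wellFounded (rank P v))
  where
    agree : ∀ v → Acc _<_ (rank P v) → p v ≡ q v
    agree v (acc smaller) with v ≟ r
    ... | yes refl = trans (root-fixed P) (sym (root-fixed Q))
    ... | no v≢r with Equivalence.to (Adj-edgesOf q) (subst (λ A → Adj A v (p v)) same (edgesOf-parent P v≢r))
    ...   | _ , inj₁ qv≡pv = sym qv≡pv
    ...   | v≢pv , inj₂ q[pv]≡v = contradiction (descends P v v≢r)
            (<-asym (moves P (trans (agree (p v) (smaller (descends P v v≢r))) q[pv]≡v) (v≢pv ∘ sym)))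

least-witness : ∀ {P : Pred ℕ 0ℓ} → Decidable P → ∀ {m} → P m → ∃ λ k → P k × (∀ {j} → j < k → ¬ P j)
least-witness P? {zero} p = 0 , p , λ ()
least-witness {P} P? {suc m} p with P? 0
... | yes p₀ = 0 , p₀ , λ ()
... | no ¬p₀ with least-witness (λ k → P? (suc k)) p
...   | k , pk , below = suc k , pk , λ { {zero} _ → ¬p₀ ; {suc j} (s≤s j<k) → below j<k }

∸-suc : ∀ {m k} → k < m → m ∸ k ≡ suc (m ∸ suc k)
∸-suc {suc m} {zero} _ = refl
∸-suc {suc m} {suc k} (s≤s k<m) = ∸-suc k<m

-- The walk x 0, …, x a = y b, …, y 0, closed up by the edge y 0 – x 0.
module ClosedWalk {A : EdgeSet n} (sym-A : ∀ {u v} → Adj A u v → Adj A v u)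
  (x y : ℕ → Fin n) (a b : ℕ)
  (x-edge : ∀ {i} → i < a → Adj A (x i) (x (suc i)))
  (y-edge : ∀ {j} → j < b → Adj A (y j) (y (suc j)))
  (x-injective : ∀ {i i′} → i ≤ a → i′ ≤ a → x i ≡ x i′ → i ≡ i′)
  (y-injective : ∀ {j j′} → j ≤ b → j′ ≤ b → y j ≡ y j′ → j ≡ j′)
  (meet-only-at-end : ∀ {i j} → i ≤ a → j ≤ b → x i ≡ y j → j ≡ b)
  (meet : x a ≡ y b)
  (closing : Adj A (y 0) (x 0)) where

  walk : ℕ → Fin n
  walk k with k ≤? a
  ... | yes _ = x k
  ... | no _ = y (a + b ∸ k)

  walk-x : ∀ {k} → k ≤ a → walk k ≡ x k
  walk-x {k} k≤a with k ≤? a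
  ... | yes _ = refl
  ... | no k≰a = contradiction k≤a k≰a

  walk-y : ∀ {k} → a ≤ k → walk k ≡ y (a + b ∸ k)
  walk-y {k} a≤k with k ≤? a
  ... | no _ = refl
  ... | yes k≤a with ≤-antisym k≤a a≤k
  ...   | refl = trans meet (cong y (sym (m+n∸m≡n a b)))

  y-index : ∀ {k} → a < k → k ≤ a + b → a + b ∸ k < b
  y-index {k} a<k k≤a+b = subst (a + b ∸ k <_) (m+n∸m≡n a b) (∸-monoʳ-< a<k k≤a+b)

  walk-injective : ∀ {k k′} → k ≤ a + b → k′ ≤ a + b → walk k ≡ walk k′ → k ≡ k′
  walk-injective {k} {k′} k≤ k′≤ e = compare (k ≤? a) (k′ ≤? a)
    where
      y-side : ∀ {i} → ¬ i ≤ a → i ≤ a + b → walk i ≡ y (a + b ∸ i) × a + b ∸ i < b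
      y-side i≰a i≤ = walk-y (<⇒≤ (≰⇒> i≰a)) , y-index (≰⇒> i≰a) i≤
      compare : Dec (k ≤ a) → Dec (k′ ≤ a) → k ≡ k′
      compare (yes k≤a) (yes k′≤a) = x-injective k≤a k′≤a (trans (sym (walk-x k≤a)) (trans e (walk-x k′≤a)))
      compare (yes k≤a) (no k′≰a) = let w , j<b = y-side k′≰a k′≤ in
        contradiction (meet-only-at-end k≤a (<⇒≤ j<b) (trans (sym (walk-x k≤a)) (trans e w))) (<⇒≢ j<b)
      compare (no k≰a) (yes k′≤a) = let w , j<b = y-side k≰a k≤ in
        contradiction (meet-only-at-end k′≤a (<⇒≤ j<b) (trans (sym (walk-x k′≤a)) (trans (sym e) w))) (<⇒≢ j<b)
      compare (no k≰a) (no k′≰a) = let w , j<b = y-side k≰a k≤ ; w′ , j′<b = y-side k′≰a k′≤ in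
        ∸-cancelˡ-≡ k≤ k′≤ (y-injective (<⇒≤ j<b) (<⇒≤ j′<b) (trans (sym w) (trans e w′)))

  walk-edge : ∀ {k} → k < a + b → Adj A (walk k) (walk (suc k))
  walk-edge {k} k< = on-side (suc k ≤? a)
    where
      on-side : Dec (k < a) → Adj A (walk k) (walk (suc k))
      on-side (yes k<a) = subst₂ (Adj A) (sym (walk-x (<⇒≤ k<a))) (sym (walk-x k<a)) (x-edge k<a)
      on-side (no k≮a) = subst₂ (Adj A) (sym (trans (walk-y a≤k) (cong y (∸-suc k<))))
                                        (sym (walk-y (≤-trans a≤k (n≤1+n k))))
                                        (sym-A (y-edge (y-index (s≤s a≤k) k<)))
        where
          a≤k : a ≤ k
          a≤k = s≤s⁻¹ (≰⇒> k≮a)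

  walk-close : Adj A (walk (a + b)) (walk 0)
  walk-close = subst₂ (Adj A) (sym (trans (walk-y (m≤m+n a b)) (cong y (n∸n≡0 (a + b))))) (sym (walk-x z≤n)) closing

  cycle : ∀ m → a + b ≡ suc (suc m) → ∃ λ c → IsCycle A m c
  cycle m length = (λ i → walk (toℕ i)) , cycle-injective , cycle-edge , cycle-close
    where
      bound : ∀ i → toℕ {suc (suc (suc m))} i ≤ a + b
      bound i = subst (toℕ i ≤_) (sym length) (s≤s⁻¹ (toℕ<n i))
      cycle-injective : ∀ {i j} → walk (toℕ i) ≡ walk (toℕ j) → i ≡ j
      cycle-injective {i} {j} e = toℕ-injective (walk-injective (bound i) (bound j) e)
      cycle-edge : ∀ i → Adj A (walk (toℕ (inject₁ i))) (walk (suc (toℕ i)))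
      cycle-edge i = subst (λ k → Adj A (walk k) (walk (suc (toℕ i)))) (sym (toℕ-inject₁ i))
                  (walk-edge (subst (toℕ i <_) (sym length) (toℕ<n i)))
      cycle-close : Adj A (walk (toℕ (fromℕ (suc (suc m))))) (walk 0)
      cycle-close = subst (λ k → Adj A (walk k) (walk 0)) (trans length (sym (toℕ-fromℕ _))) walk-close

module Ancestors {r : Fin n} {p : Fin n → Fin n} (P : IsParentFunction r p) where

  ancestor : ℕ → Fin n → Fin n
  ancestor k v = fold v p k

  ancestor-root : ∀ k → ancestor k r ≡ r
  ancestor-root zero = refl
  ancestor-root (suc k) = trans (cong p (ancestor-root k)) (root-fixed P)

  ancestor-suc : ∀ k v → ancestor (suc k) v ≡ ancestor k (p v)
  ancestor-suc zero v = refl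
  ancestor-suc (suc k) v = cong p (ancestor-suc k v)

  ancestor-rank : ∀ {k} v → rank P v ≤ k → ancestor k v ≡ r
  ancestor-rank {k} v rank≤k with v ≟ r
  ... | yes refl = ancestor-root k
  ancestor-rank {zero} v rank≤0 | no v≢r = contradiction (<-≤-trans (descends P v v≢r) rank≤0) λ ()
  ancestor-rank {suc k} v rank≤k | no v≢r =
    trans (ancestor-suc k v) (ancestor-rank (p v) (s≤s⁻¹ (<-≤-trans (descends P v v≢r) rank≤k)))

  ancestor-stays : ∀ {j k} v → j ≤ k → ancestor j v ≡ r → ancestor k v ≡ r
  ancestor-stays {j} {k} v j≤k reached = begin
    ancestor k v                     ≡⟨ cong (fold v p) (m∸n+n≡m j≤k) ⟨
    ancestor (k ∸ j + j) v           ≡⟨ fold-+ v p (k ∸ j) ⟩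
    ancestor (k ∸ j) (ancestor j v)  ≡⟨ cong (ancestor (k ∸ j)) reached ⟩
    ancestor (k ∸ j) r               ≡⟨ ancestor-root (k ∸ j) ⟩
    r                                ∎
    where open ≡-Reasoning

  module _ {v L} (below-root : ∀ {i} → i < L → ancestor i v ≢ r) where

    ancestors-descend : ∀ {i j} → i < j → j ≤ L → rank P (ancestor j v) < rank P (ancestor i v)
    ancestors-descend {i} {suc j} (s≤s i≤j) j<L with m≤n⇒m<n∨m≡n i≤j
    ... | inj₂ refl = descends P _ (below-root j<L)
    ... | inj₁ i<j = <-trans (descends P _ (below-root j<L)) (ancestors-descend i<j (<⇒≤ j<L))

    ancestors-injective : ∀ {i j} → i ≤ L → j ≤ L → ancestor i v ≡ ancestor j v → i ≡ j
    ancestors-injective {i} {j} i≤L j≤L e with <-cmp i j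
    ... | tri< i<j _ _ = contradiction (cong (rank P) (sym e)) (<⇒≢ (ancestors-descend i<j j≤L))
    ... | tri≈ _ i≡j _ = i≡j
    ... | tri> _ _ j<i = contradiction (cong (rank P) e) (<⇒≢ (ancestors-descend j<i i≤L))

  module FirstMeeting (u v : Fin n) where

    B : ℕ
    B = rank P v

    v-chain-ends : ancestor B v ≡ r
    v-chain-ends = ancestor-rank v ≤-refl

    OnVChain : ℕ → Set
    OnVChain i = ∃ λ (j : Fin (suc B)) → ancestor i u ≡ ancestor (toℕ j) v

    first-meeting : ∃ λ a → OnVChain a × (∀ {i} → i < a → ¬ OnVChain i)
    first-meeting = least-witness (λ i → any? λ (j : Fin (suc B)) → ancestor i u ≟ ancestor (toℕ j) v)
      {rank P u} (fromℕ B , trans (ancestor-rank u ≤-refl)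
                                  (sym (trans (cong (λ k → ancestor k v) (toℕ-fromℕ B)) v-chain-ends)))
    a : ℕ
    a = proj₁ first-meeting

    a-least : ∀ {i} → i < a → ¬ OnVChain i
    a-least = proj₂ (proj₂ first-meeting)

    j₀ : Fin (suc B)
    j₀ = proj₁ (proj₁ (proj₂ first-meeting))

    meet₀ : ancestor a u ≡ ancestor (toℕ j₀) v
    meet₀ = proj₂ (proj₁ (proj₂ first-meeting))

    second-meeting : ∃ λ b → ancestor a u ≡ ancestor b v × (∀ {j} → j < b → ancestor a u ≢ ancestor j v)
    second-meeting = least-witness (λ j → ancestor a u ≟ ancestor j v) {toℕ j₀} meet₀

    b : ℕ
    b = proj₁ second-meeting

    meet : ancestor a u ≡ ancestor b v
    meet = proj₁ (proj₂ second-meeting)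

    b-least : ∀ {j} → j < b → ancestor a u ≢ ancestor j v
    b-least = proj₂ (proj₂ second-meeting)

    b≤B : b ≤ B
    b≤B = ≤-trans (≮⇒≥ λ j₀<b → b-least j₀<b meet₀) (s≤s⁻¹ (toℕ<n j₀))

    on-v-chain : ∀ {i j} → j ≤ B → ancestor i u ≡ ancestor j v → OnVChain i
    on-v-chain j≤B e = fromℕ< (s≤s j≤B) , trans e (cong (λ k → ancestor k v) (sym (toℕ-fromℕ< (s≤s j≤B))))

    u-below-root : ∀ {i} → i < a → ancestor i u ≢ r
    u-below-root {i} i<a reached = a-least i<a (on-v-chain {i} ≤-refl (trans reached (sym v-chain-ends)))

    v-below-root : ∀ {j} → j < b → ancestor j v ≢ r
    v-below-root j<b reached = b-least j<b (trans meet (trans (ancestor-stays v (<⇒≤ j<b) reached) (sym reached)))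

    meet-only-at-end : ∀ {i j} → i ≤ a → j ≤ b → ancestor i u ≡ ancestor j v → j ≡ b
    meet-only-at-end {i} i≤a j≤b e with m≤n⇒m<n∨m≡n i≤a | m≤n⇒m<n∨m≡n j≤b
    ... | inj₁ i<a | _ = contradiction (on-v-chain {i} (≤-trans j≤b b≤B) e) (a-least i<a)
    ... | inj₂ refl | inj₁ j<b = contradiction e (b-least j<b)
    ... | inj₂ refl | inj₂ j≡b = j≡b

module _ {A : EdgeSet n} (sym-A : ∀ {u v} → Adj A u v → Adj A v u) (loopless : ∀ u → ¬ Adj A u u)
         (acyclic : Acyclic A) {r p} (P : IsParentFunction r p)
         (parent-in-A : ∀ {v} → v ≢ r → Adj A v (p v)) where
  open Ancestors P

  -- a and b are the first indices at which the ancestor chains of u and v meet; unless uv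
  -- is a parent edge, the two chains and uv form a cycle.
  only-parent-edges : ∀ {u v} → Adj A u v → p u ≡ v ⊎ p v ≡ u
  only-parent-edges {u} {v} uv = conclude a b meet no-cycle
    where
      open FirstMeeting u v

      no-cycle : ∀ m → a + b ≡ suc (suc m) → ⊥
      no-cycle m length =
        let c , is-cycle = ClosedWalk.cycle {A = A} sym-A (λ i → ancestor i u) (λ j → ancestor j v) a b
                             (parent-in-A ∘ u-below-root) (parent-in-A ∘ v-below-root)
                             (ancestors-injective u-below-root) (ancestors-injective v-below-root)
                             meet-only-at-end meet (sym-A uv) m length
        in acyclic m c is-cycle

      conclude : ∀ a b → ancestor a u ≡ ancestor b v → (∀ m → a + b ≡ suc (suc m) → ⊥) → p u ≡ v ⊎ p v ≡ u
      conclude zero zero u≡v _ = contradiction (subst (Adj A u) (sym u≡v) uv) (loopless u)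
      conclude 1 zero pu≡v _ = inj₁ pu≡v
      conclude zero 1 u≡pv _ = inj₂ (sym u≡pv)
      conclude (suc (suc a)) b _ acyclic′ = ⊥-elim (acyclic′ (a + b) refl)
      conclude 1 (suc b) _ acyclic′ = ⊥-elim (acyclic′ b refl)
      conclude zero (suc (suc b)) _ acyclic′ = ⊥-elim (acyclic′ b refl)

module BreadthFirst {A : EdgeSet n} (connected : Connected A) (r : Fin n) where

  Within : ℕ → Pred (Fin n) 0ℓ
  Within zero v = v ≡ r
  Within (suc k) v = Within k v ⊎ ∃ λ w → Adj A v w × Within k w

  within? : ∀ k → Decidable (Within k)
  within? zero v = v ≟ r
  within? (suc k) v = within? k v ⊎-dec any? λ w → T? (lookup (lookup A v) w) ×-dec within? k w

  walk⇒within : ∀ {v} → Walk A v r → ∃ λ k → Within k v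
  walk⇒within here = 0 , refl
  walk⇒within (step adj w) = let k , within = walk⇒within w in suc k , inj₂ (_ , adj , within)

  shortest : ∀ v → ∃ λ k → Within k v × (∀ {j} → j < k → ¬ Within j v)
  shortest v = least-witness (λ k → within? k v) (proj₂ (walk⇒within (connected v r)))

  distance : Fin n → ℕ
  distance v = proj₁ (shortest v)

  distance-least-witness : ∀ {k v} → Within k v → distance v ≤ k
  distance-least-witness {k} {v} within = ≮⇒≥ λ k<d → proj₂ (proj₂ (shortest v)) k<d within

  closer-neighbour : ∀ {v} m → Within m v → (∀ {j} → j < m → ¬ Within j v) → v ≢ r →
                     ∃ λ w → Adj A v w × distance w < m
  closer-neighbour zero v≡r _ v≢r = contradiction v≡r v≢r
  closer-neighbour (suc k) (inj₁ within) minimal _ = contradiction within (minimal (n<1+n k))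
  closer-neighbour (suc k) (inj₂ (w , adj , within)) _ _ = w , adj , s≤s (distance-least-witness within)

  step-toward-root : ∀ {v} → v ≢ r → ∃ λ w → Adj A v w × distance w < distance v
  step-toward-root {v} = closer-neighbour (distance v) (proj₁ (proj₂ (shortest v))) (proj₂ (proj₂ (shortest v)))

  parent : Fin n → Fin n
  parent v with v ≟ r
  ... | yes _ = r
  ... | no v≢r = proj₁ (step-toward-root v≢r)

  parent-adj : ∀ {v} → v ≢ r → Adj A v (parent v)
  parent-adj {v} v≢r with v ≟ r
  ... | yes v≡r = contradiction v≡r v≢r
  ... | no v≢r′ = proj₁ (proj₂ (step-toward-root v≢r′))

  parent-isParentFunction : IsParentFunction r parent
  parent-isParentFunction = record { root-fixed = root-fixed′ ; rank = distance ; descends = descends′ }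
    where
      root-fixed′ : parent r ≡ r
      root-fixed′ with r ≟ r
      ... | yes _ = refl
      ... | no r≢r = contradiction refl r≢r
      descends′ : ∀ v → v ≢ r → distance (parent v) < distance v
      descends′ v v≢r with v ≟ r
      ... | yes v≡r = contradiction v≡r v≢r
      ... | no v≢r′ = proj₂ (proj₂ (step-toward-root v≢r′))

spanningTree⇒edgesOf : ∀ {A : EdgeSet n} → IsSpanningTree A → ∀ r →
                       ∃ λ p → IsParentFunction r p × edgesOf p ≡ A
spanningTree⇒edgesOf {A = A} ((sym-A , loopless) , connected , acyclic) r =
  parent , parent-isParentFunction , EdgeSet-ext λ u v → mk⇔ (tree-edge u v) (edgesOf-edge u v)
  where
    open BreadthFirst connected r
    P : IsParentFunction r parent
    P = parent-isParentFunction
    tree-edge : ∀ u v → Adj (edgesOf parent) u v → Adj A u v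
    tree-edge u v adj with Equivalence.to (Adj-edgesOf parent) adj
    ... | u≢v , inj₁ pu≡v = subst (Adj A u) pu≡v (parent-adj (moving⇒nonroot P pu≡v u≢v))
    ... | u≢v , inj₂ pv≡u = sym-A _ _ (subst (Adj A v) pv≡u (parent-adj (moving⇒nonroot P pv≡u (u≢v ∘ sym))))
    edgesOf-edge : ∀ u v → Adj A u v → Adj (edgesOf parent) u v
    edgesOf-edge u v adj = Equivalence.from (Adj-edgesOf parent)
      ((λ { refl → loopless u adj }) , only-parent-edges {A = A} (sym-A _ _) loopless acyclic P parent-adj adj)

module RootAndHighestChild {N : ℕ} (r h : Fin N) (h<r : toℕ h < toℕ r) where

  h≢r : h ≢ r
  h≢r h≡r = <-irrefl (cong toℕ h≡r) h<r

  role : Fin N → Role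
  role v with v ≟ r
  ... | yes _ = plain root
  ... | no _ with <-cmp (toℕ v) (toℕ h)
  ...   | tri< _ _ _ = free
  ...   | tri≈ _ _ _ = child
  ...   | tri> _ _ _ = nonchild

  data RoleView (v : Fin N) : Role → Set where
    is-root  : v ≡ r → RoleView v (plain root)
    below-h  : toℕ v < toℕ h → RoleView v free
    is-h     : v ≡ h → RoleView v child
    above-h  : v ≢ r → toℕ h < toℕ v → RoleView v nonchild

  role-view : ∀ v → RoleView v (role v)
  role-view v with v ≟ r
  ... | yes v≡r = is-root v≡r
  ... | no v≢r with <-cmp (toℕ v) (toℕ h)
  ...   | tri< v<h _ _ = below-h v<h
  ...   | tri≈ _ v≡h _ = is-h (toℕ-injective v≡h)
  ...   | tri> _ _ h<v = above-h v≢r h<v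

  role-root : role r ≡ plain root
  role-root with role r | role-view r
  ... | _ | is-root _ = refl
  ... | _ | below-h r<h = contradiction (<-≤-trans r<h (<⇒≤ h<r)) (<-irrefl refl)
  ... | _ | is-h refl = contradiction refl h≢r
  ... | _ | above-h r≢r _ = contradiction refl r≢r

  role-h : role h ≡ child
  role-h with role h | role-view h
  ... | _ | is-root h≡r = contradiction h≡r h≢r
  ... | _ | below-h h<h = contradiction h<h (<-irrefl refl)
  ... | _ | is-h _ = refl
  ... | _ | above-h _ h<h = contradiction h<h (<-irrefl refl)

  role-child : ∀ {v} → role v ≡ child → v ≡ h
  role-child {v} c with role v | role-view v
  role-child () | _ | is-root _
  role-child () | _ | below-h _
  role-child refl | _ | is-h v≡h = v≡h
  role-child () | _ | above-h _ _

  role-nonchild : ∀ {v} → role v ≡ nonchild → v ≢ r × toℕ h < toℕ v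
  role-nonchild {v} nc with role v | role-view v
  role-nonchild () | _ | is-root _
  role-nonchild () | _ | below-h _
  role-nonchild () | _ | is-h _
  role-nonchild refl | _ | above-h v≢r h<v = v≢r , h<v

  role-free : ∀ {v} → role v ≡ free → toℕ v < toℕ h
  role-free {v} f with role v | role-view v
  role-free () | _ | is-root _
  role-free refl | _ | below-h v<h = v<h
  role-free () | _ | is-h _
  role-free () | _ | above-h _ _

  below⇒free : ∀ {v} → toℕ v < toℕ h → role v ≡ free
  below⇒free {v} v<h with role v | role-view v
  ... | _ | is-root refl = contradiction (<-≤-trans v<h (<⇒≤ h<r)) (<-irrefl refl)
  ... | _ | below-h _ = refl
  ... | _ | is-h refl = contradiction v<h (<-irrefl refl)
  ... | _ | above-h _ h<v = contradiction v<h (<-asym h<v)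

  above⇒nonchild : ∀ {v} → v ≢ r → toℕ h < toℕ v → role v ≡ nonchild
  above⇒nonchild {v} v≢r h<v with role v | role-view v
  ... | _ | is-root v≡r = contradiction v≡r v≢r
  ... | _ | below-h v<h = contradiction v<h (<-asym h<v)
  ... | _ | is-h refl = contradiction h<v (<-irrefl refl)
  ... | _ | above-h _ _ = refl

  nonroot⇒inner : ∀ {v} → v ≢ r → shape (role v) ≡ inner
  nonroot⇒inner {v} v≢r with role v | role-view v
  ... | _ | is-root v≡r = contradiction v≡r v≢r
  ... | _ | below-h _ = refl
  ... | _ | is-h _ = refl
  ... | _ | above-h _ _ = refl

  inner⇒nonroot : ∀ {v} → shape (role v) ≡ inner → v ≢ r
  inner⇒nonroot v-inner refl with () ← trans (sym (cong shape role-root)) v-inner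

  role-present : ∀ v → shape (role v) ≢ absent
  role-present v with role v | role-view v
  ... | _ | is-root _ = λ ()
  ... | _ | below-h _ = λ ()
  ... | _ | is-h _ = λ ()
  ... | _ | above-h _ _ = λ ()

  reroot-h : reroot r role h ≡ root
  reroot-h = trans (reroot-other role h≢r) (cong promote role-h)

  reroot-root⇒h : ∀ {v} → reroot r role v ≡ root → v ≡ h
  reroot-root⇒h {v} v-root with v ≟ r
  ... | yes refl = case trans (sym (reroot-self r role)) v-root of λ ()
  ... | no v≢r with role v | role-view v | trans (sym (reroot-other role v≢r)) v-root
  ...   | _ | is-h v≡h | _ = v≡h
  ...   | _ | is-root v≡r | _ = contradiction v≡r v≢r
  ...   | _ | below-h _ | ()
  ...   | _ | above-h _ _ | ()

  nonroot⇔reroot-inner : ∀ {v} → v ≢ h → (v ≢ r) ⇔ (reroot r role v ≡ inner)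
  nonroot⇔reroot-inner {v} v≢h = mk⇔ from to
    where
      to : reroot r role v ≡ inner → v ≢ r
      to v-inner refl = case trans (sym (reroot-self r role)) v-inner of λ ()
      from : v ≢ r → reroot r role v ≡ inner
      from v≢r with role v | role-view v | reroot-other role v≢r
      ... | _ | is-root v≡r | _ = contradiction v≡r v≢r
      ... | _ | below-h _ | e = e
      ... | _ | is-h v≡h | _ = contradiction v≡h v≢h
      ... | _ | above-h _ _ | e = e

  #free-role : #free role ≡ toℕ h
  #free-role = begin
    #free role                        ≡⟨ count-cong _ (λ v → toℕ v <? toℕ h) (role-free , below⇒free) ⟩
    count {N} (λ v → toℕ v <? toℕ h)  ≡⟨ count-below (toℕ h) (<⇒≤ (toℕ<n h)) ⟩
    toℕ h                             ∎
    where open ≡-Reasoning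

  #roots-reroot : #roots (reroot r role) ≡ 1
  #roots-reroot = trans (count-except _ (λ _ → no λ ()) h reroot-h (λ ())
                          λ v≢h → mk⇔ (v≢h ∘ reroot-root⇒h) λ ())
                        (cong suc (count-empty (λ (_ : Fin N) → no λ ()) λ _ ()))

  #inner-reroot : suc (suc (#inner (reroot r role))) ≡ N
  #inner-reroot = begin
    suc (suc (#inner (reroot r role)))  ≡⟨ cong suc all-but-r ⟨
    suc (count nonroot?)                ≡⟨ all ⟨
    count {N} (λ _ → yes tt)            ≡⟨ count-universal _ (λ _ → tt) ⟩
    N                                   ∎
    where
      open ≡-Reasoning
      nonroot? : Decidable (_≢ r)
      nonroot? v = ¬? (v ≟ r)
      all : count {N} (λ _ → yes tt) ≡ suc (count nonroot?)
      all = count-except _ nonroot? r tt (λ r≢r → r≢r refl) (λ v≢r → mk⇔ (λ _ → v≢r) (λ _ → tt))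
      all-but-r : count nonroot? ≡ suc (#inner (reroot r role))
      all-but-r = count-except nonroot? _ h h≢r (λ h-inner → case trans (sym reroot-h) h-inner of λ ())
                    nonroot⇔reroot-inner

  forest⇒parentFunction : ∀ {p} → IsForest (shape ∘ role) p → IsParentFunction r p
  forest⇒parentFunction F = record
    { root-fixed = IsForest.fixed F r (λ r-inner → case trans (sym (cong shape role-root)) r-inner of λ ())
    ; rank = IsForest.rank F
    ; descends = λ v v≢r → IsForest.descends F v (nonroot⇒inner v≢r) }

  parentFunction⇒forest : ∀ {p} → IsParentFunction r p → IsForest (shape ∘ role) p
  parentFunction⇒forest {p} P = record
    { fixed = λ v ¬inner → case v ≟ r of λ
        { (yes refl) → IsParentFunction.root-fixed P
        ; (no v≢r) → contradiction (nonroot⇒inner v≢r) ¬inner }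
    ; closed = λ v _ → role-present (p v)
    ; rank = IsParentFunction.rank P
    ; descends = λ v v-inner → IsParentFunction.descends P v (inner⇒nonroot v-inner) }

  edgesOf-uprooted : ∀ {p} → IsConstrainedForest r role p → InT ⟦ r ⟧ ⟦ h ⟧ (edgesOf p)
  edgesOf-uprooted {p} P =
    edgesOf-isSpanningTree PF , r , refl , (λ c adj → s≤s (≤-<-trans (child≤h adj) h<r)) ,
      h , refl , Equivalence.from (Adj-edgesOf p) (h≢r ∘ sym , inj₂ (children P h role-h)) ,
    λ c adj → s≤s (child≤h adj)
    where
      open IsConstrainedForest
      PF : IsParentFunction r p
      PF = forest⇒parentFunction (forest P)
      child≤h : ∀ {c} → Adj (edgesOf p) r c → toℕ c ≤ toℕ h
      child≤h {c} adj = ≮⇒≥ λ h<c → nonchildren P c (above⇒nonchild c≢r h<c) (edgesOf-child PF adj)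
        where c≢r = λ { refl → proj₂ (edgesOf-simple PF) r adj }

  uprooted⇒edgesOf : ∀ {A} → InT ⟦ r ⟧ ⟦ h ⟧ A → ∃ λ p → IsConstrainedForest r role p × edgesOf p ≡ A
  uprooted⇒edgesOf {A} (tree , r′ , r′≡r , _ , h′ , h′≡h , h-child , highest)
    with toℕ-injective (suc-injective r′≡r) | toℕ-injective (suc-injective h′≡h)
  ... | refl | refl = p , P , edges≡
    where
      parents : ∃ λ p → IsParentFunction r p × edgesOf p ≡ A
      parents = spanningTree⇒edgesOf tree r
      p : Fin N → Fin N
      p = proj₁ parents
      PF : IsParentFunction r p
      PF = proj₁ (proj₂ parents)
      edges≡ : edgesOf p ≡ A
      edges≡ = proj₂ (proj₂ parents)
      children′ : ∀ v → role v ≡ child → p v ≡ r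
      children′ v c with role-child {v} c
      ... | refl = edgesOf-child PF (subst (λ B → Adj B r h) (sym edges≡) h-child)
      nonchildren′ : ∀ v → role v ≡ nonchild → p v ≢ r
      nonchildren′ v nc pv≡r = let v≢r , h<v = role-nonchild nc in
        <⇒≱ (s≤s h<v) (highest v (subst (λ B → Adj B r v) edges≡
          (Equivalence.from (Adj-edgesOf p) (v≢r ∘ sym , inj₂ pv≡r))))
      P : IsConstrainedForest r role p
      P = record { forest = parentFunction⇒forest PF ; children = children′ ; nonchildren = nonchildren′ }

  uprooted-enumeration : ∀ {K} → Enumeration _≗_ (IsConstrainedForest r role) K →
                         Enumeration _≡_ (InT ⟦ r ⟧ ⟦ h ⟧) K
  uprooted-enumeration = Enumeration-image edgesOf edgesOf-cong trans
    (λ P Q → edgesOf-injective (parentFunction P) (parentFunction Q)) edgesOf-uprooted uprooted⇒edgesOf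
    where
      parentFunction : ∀ {p} → IsConstrainedForest r role p → IsParentFunction r p
      parentFunction = forest⇒parentFunction ∘ IsConstrainedForest.forest

uprooted-trees : ∀ u t (r h : Fin (suc (suc (u + t)))) → toℕ h ≡ u → toℕ h < toℕ r →
                 Enumeration _≡_ (InT ⟦ r ⟧ ⟦ h ⟧) (constrainedForests u t 1)
uprooted-trees u t r h h≡u h<r = uprooted-enumeration
  (constrained-enumeration (forest-enumeration (u + t + 1)) u t 1 role-root
    (trans #free-role h≡u) (suc-injective (suc-injective #inner-reroot)) #roots-reroot refl)
  where open RootAndHighestChild r h h<r

vertex-split : ∀ n k j → 2 ≤ n → k ≤ n ∸ 2 → suc j ≤ n ∸ k ∸ 1 → ∃ λ u → n ≡ suc (suc (u + (k + j)))
vertex-split n k j 2≤n k≤n∸2 j<n∸k = n ∸ m , trans (sym (m∸n+n≡m m≤n)) (reorder (n ∸ m) j k)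
  where
    m : ℕ
    m = suc j + (k + 1)
    k+1≤n : k + 1 ≤ n
    k+1≤n = ≤-trans (+-monoʳ-≤ k (n≤1+n 1)) (m≤o∸n⇒m+n≤o k 2≤n k≤n∸2)
    m≤n : m ≤ n
    m≤n = m≤o∸n⇒m+n≤o (suc j) k+1≤n (subst (suc j ≤_) (∸-+-assoc n k 1) j<n∸k)
    reorder : ∀ u j k → u + (suc j + (k + 1)) ≡ suc (suc (u + (k + j)))
    reorder = solve-∀

-- For n = u + k + j + 2 (this j is one less than the paper's), the root n - k and its highest
-- child n - k - (j + 1) are the vertices with indices u + j + 1 and u.
module Labels (u k j : ℕ) where

  N : ℕ
  N = suc (suc (u + (k + j)))

  root-label : N ∸ k ≡ suc (u + suc j)
  root-label = trans (cong (_∸ k) (reorder u k j)) (m+n∸m≡n k _)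
    where
      reorder : ∀ u k j → suc (suc (u + (k + j))) ≡ k + suc (u + suc j)
      reorder = solve-∀

  child-label : N ∸ k ∸ suc j ≡ suc u
  child-label = trans (cong (_∸ suc j) root-label) (m+n∸n≡m (suc u) (suc j))

  last-factor : 2 * N ∸ k ∸ suc j ∸ 1 ≡ N + u
  last-factor = begin
    2 * N ∸ k ∸ suc j ∸ 1                       ≡⟨ ∸-+-assoc (2 * N ∸ k) (suc j) 1 ⟩
    2 * N ∸ k ∸ (suc j + 1)                     ≡⟨ ∸-+-assoc (2 * N) k (suc j + 1) ⟩
    2 * N ∸ (k + (suc j + 1))                   ≡⟨ cong (_∸ (k + (suc j + 1))) (reorder u k j) ⟩
    N + u + (k + (suc j + 1)) ∸ (k + (suc j + 1)) ≡⟨ m+n∸n≡m (N + u) (k + (suc j + 1)) ⟩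
    N + u                                       ∎
    where
      open ≡-Reasoning
      reorder : ∀ u k j → 2 * suc (suc (u + (k + j))) ≡ suc (suc (u + (k + j))) + u + (k + (suc j + 1))
      reorder = solve-∀

  uprooted-trees-labelled :
    Enumeration _≡_ (InT (N ∸ k) (N ∸ k ∸ suc j)) (constrainedForests u (k + j) 1)
  uprooted-trees-labelled = subst₂ (λ a b → Enumeration _≡_ (InT {N} a b) (constrainedForests u (k + j) 1))
    (trans (cong suc (toℕ-fromℕ< r<N)) (sym root-label))
    (trans (cong suc (toℕ-fromℕ< h<N)) (sym child-label))
    (uprooted-trees u (k + j) (fromℕ< r<N) (fromℕ< h<N) (toℕ-fromℕ< h<N)
      (subst₂ _<_ (sym (toℕ-fromℕ< h<N)) (sym (toℕ-fromℕ< r<N)) (m<m+n u (s≤s z≤n))))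
    where
      r<N : u + suc j < N
      r<N = s≤s (subst (u + suc j ≤_) (reorder u k j) (m≤m+n (u + suc j) k))
        where reorder : ∀ u k j → u + suc j + k ≡ suc (u + (k + j))
              reorder = solve-∀
      h<N : u < N
      h<N = s≤s (≤-trans (m≤m+n u (k + j)) (n≤1+n _))

  formula : ∀ {ℓ} → ℓ ≡ constrainedForests u (k + j) 1 →
    ℓ * (N * (N ∸ 1)) ≡ N ^ (N ∸ k ∸ suc j ∸ 1) * (N ∸ 1) ^ (k + suc j ∸ 1) * (2 * N ∸ k ∸ suc j ∸ 1)
  formula {ℓ} refl = begin
    C * (N * M)                                 ≡⟨ regroup C N M ⟩
    M * N * C                                   ≡⟨ constrainedForests-closed M u (k + j) 1 (+-comm _ 1) ⟩
    M ^ (k + j) * N ^ u * (1 * N + u)           ≡⟨ regroup′ N u (M ^ (k + j)) (N ^ u) ⟩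
    N ^ u * M ^ (k + j) * (N + u)
      ≡⟨ cong₂ (λ e e′ → N ^ e * M ^ e′ * (N + u)) (cong (_∸ 1) child-label) (cong (_∸ 1) (+-suc k j)) ⟨
    N ^ (N ∸ k ∸ suc j ∸ 1) * M ^ (k + suc j ∸ 1) * (N + u)
      ≡⟨ cong (N ^ (N ∸ k ∸ suc j ∸ 1) * M ^ (k + suc j ∸ 1) *_) last-factor ⟨
    N ^ (N ∸ k ∸ suc j ∸ 1) * M ^ (k + suc j ∸ 1) * (2 * N ∸ k ∸ suc j ∸ 1) ∎
    where
      open ≡-Reasoning
      M C : ℕ
      M = N ∸ 1
      C = constrainedForests u (k + j) 1
      regroup : ∀ C N M → C * (N * M) ≡ M * N * C
      regroup = solve-∀
      regroup′ : ∀ N u X Y → X * Y * (1 * N + u) ≡ Y * X * (N + u)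
      regroup′ = solve-∀

theorem4p1 : (n k j : ℕ) → 2 ≤ n → k ≤ n ∸ 2 → 1 ≤ j → j ≤ n ∸ k ∸ 1 →
    Σ (List (EdgeSet n)) (λ L →
      Unique L ×
      (∀ (A : EdgeSet n) → (A ∈ L) ⇔ InT (n ∸ k) (n ∸ k ∸ j) A) ×
      length L * (n * (n ∸ 1)) ≡
        n ^ (n ∸ k ∸ j ∸ 1) * (n ∸ 1) ^ (k + j ∸ 1) * (2 * n ∸ k ∸ j ∸ 1))
theorem4p1 n k zero _ _ () _
theorem4p1 n k (suc j) 2≤n k≤n∸2 _ j<n∸k with vertex-split n k j 2≤n k≤n∸2 j<n∸k
... | u , refl =
  let L , unique , membership , length≡ = Enumeration⇒List (Labels.uprooted-trees-labelled u k j)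
  in L , unique , membership , Labels.formula u k j length≡
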